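{- Let \(\mathcal U\), \(\mathcal V\) and \(\mathcal T\) be universes and let \(P_{\mathcal U}\) be a proposition in \(\mathcal U\). Consider the poset \(\mathcal L_{\mathcal V}(P_{\mathcal U}):=\Sigma_{Q:\Omega_{\mathcal V}}(Q\to P_{\mathcal U})\), ordered by \((Q,f)\sqsubseteq(Q',f')\) iff \(Q\to Q'\). If every subset \(S:\mathcal L_{\mathcal V}(P_{\mathcal U})\to\Omega_{\mathcal T}\) has a supremum in \(\mathcal L_{\mathcal V}(P_{\mathcal U})\), then \(P_{\mathcal U}\) has size \(\mathcal V\).
   Context: Setting: intensional Martin-Löf type theory with universes, function extensionality, propositional extensionality, propositional truncation; excluded middle and resizing are not assumed. A proposition is a type with at most one element; \(\Omega_{\mathcal V}\) is the type of propositions in \(\mathcal V\). A type has size \(\mathcal V\) if it is equivalent to some type in \(\mathcal V\). A subset of \(X\) is a map \(S:X\to\Omega_{\mathcal T}\); a supremum of \(S\) is a least upper bound of the elements \(x\) for which \(S(x)\) holds. -}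

module Defs where

open import Level using (Level; _⊔_; suc)
open import Data.Product using (Σ; Σ-syntax; _,_; proj₁; proj₂)
open import Relation.Binary.PropositionalEquality using (_≡_)
open import Function.Bundles using (_↔_)

isProp : ∀ {u} → Set u → Set u
isProp A = (x y : A) → x ≡ y

Ω : (v : Level) → Set (suc v)
Ω v = Σ[ Q ∈ Set v ] isProp Q

_holds : ∀ {v} → Ω v → Set v
Q holds = proj₁ Q

𝓛 : ∀ {u} (v : Level) → Set u → Set (u ⊔ suc v)
𝓛 v P = Σ[ Q ∈ Ω v ] (Q holds → P)

_⊑_ : ∀ {u v} {P : Set u} → 𝓛 v P → 𝓛 v P → Set v
(Q , _) ⊑ (Q' , _) = Q holds → Q' holds

IsSup : ∀ {u v t} {P : Set u} → (𝓛 v P → Ω t) → 𝓛 v P → Set (u ⊔ suc v ⊔ t)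
IsSup {P = P} S s =
  ((x : 𝓛 _ P) → S x holds → x ⊑ s)
  × ((y : 𝓛 _ P) → ((x : 𝓛 _ P) → S x holds → x ⊑ y) → s ⊑ y)
  where open import Data.Product using (_×_)

HasSize : ∀ {u} → Set u → (v : Level) → Set (u ⊔ suc v)
HasSize X v = Σ[ Y ∈ Set v ] (X ↔ Y)

{-# OPTIONS --safe #-}
module Submission where

-- The supremum of the full subset of 𝓛_V(P) lies above (⊤, λ _ → p) for
-- every p : P, so its V-small proposition holds as soon as P does; it maps
-- back into P by construction, and logically equivalent propositions are
-- equivalent.

open import Defs
open import Level using (Level)
open import Data.Product using (Σ-syntax; _,_)
open import Data.Unit.Polymorphic using (⊤; tt)
open import Function.Bundles using (mk↔ₛ′)
open import Relation.Binary.PropositionalEquality using (refl)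

⊤Ω : ∀ {v} → Ω v
⊤Ω = ⊤ , λ _ _ → refl

fullSubset : ∀ {u v t} {P : Set u} → 𝓛 v P → Ω t
fullSubset _ = ⊤Ω

constant𝓛 : ∀ {u} v {P : Set u} → P → 𝓛 v P
constant𝓛 v p = ⊤Ω {v} , λ _ → p

upperBoundOfAll⇒hasSize : ∀ {u v} {P : Set u} → isProp P → (s : 𝓛 v P)
  → ((x : 𝓛 v P) → x ⊑ s) → HasSize P v
upperBoundOfAll⇒hasSize {v = v} {P} isPropP ((Q , isPropQ) , Q→P) below =
  Q , mk↔ₛ′ P→Q Q→P (λ _ → isPropQ _ _) (λ _ → isPropP _ _)
  where
  P→Q : P → Q
  P→Q p = below (constant𝓛 v p) tt

theorem5p1 : {u v t : Level} (P : Set u) → isProp P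
             → ((S : 𝓛 v P → Ω t) → Σ[ s ∈ 𝓛 v P ] IsSup S s)
             → HasSize P v
theorem5p1 P isPropP sup =
  let (s , isUpperBound , _) = sup fullSubset
  in upperBoundOfAll⇒hasSize isPropP s (λ x → isUpperBound x tt)
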